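{- Every Fitch map $\varepsilon\colon X^{\times}_{\mathrm{irr}}\to\mathcal{P}(M)$ satisfies the inequality-condition: for every $N=N_m[y]\in\mathcal{N}[\varepsilon]$ and every $y'\in N$ we have $|N_m[y']|\le|N|$.
   Context: $X$ is a finite nonempty set, $M$ a finite nonempty set of colors, $X^{\times}_{\mathrm{irr}}=\{(x,y)\in X\times X: x\neq y\}$. A phylogenetic tree on $X$ is a rooted tree whose leaves (non-root vertices of degree $1$) form $X$, whose root has degree $\ge2$ and whose non-root inner vertices have degree $\ge3$. $\mathrm{lca}(x,y)$ denotes the last common ancestor of $x,y$. An edge-labeled tree $(T,\lambda)$ on $X$ with $M$ is a phylogenetic tree $T$ on $X$ with $\lambda\colon E(T)\to\mathcal{P}(M)$; $e$ is an $m$-edge if $m\in\lambda(e)$. $(T,\lambda)$ explains $\varepsilon\colon X^{\times}_{\mathrm{irr}}\to\mathcal{P}(M)$ if for all $(x,y)\in X^{\times}_{\mathrm{irr}}$, $m\in M$: $m\in\varepsilon(x,y)$ iff the path from $\mathrm{lca}(x,y)$ to $y$ contains an $m$-edge; $\varepsilon$ is a Fitch map if some edge-labeled tree explains it. $N_m[y]=\{x\in X\setminus\{y\}: m\notin\varepsilon(x,y)\}\cup\{y\}$ and $\mathcal{N}[\varepsilon]=\{N_m[y]: y\in X, m\in M\}$. -}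

module Defs where

open import Data.Nat using (ℕ; suc; _≤_)
open import Data.Fin using (Fin; _≟_)
open import Data.Fin.Subset using (Subset; _∈_; _∉_; inside; outside; ∣_∣)
open import Data.Fin.Subset.Properties using (_∈?_)
open import Data.Vec using (tabulate)
open import Data.List using (List; []; _∷_; _++_; length; allFin)
open import Data.List.Relation.Unary.All using (All)
open import Data.List.Relation.Binary.Permutation.Propositional using (_↭_)
import Data.List.Membership.Propositional as LM
open import Data.Product using (Σ; ∃; _×_; _,_; proj₂)
open import Data.Sum using (_⊎_)
open import Relation.Binary.PropositionalEquality using (_≢_)
open import Relation.Nullary using (¬_; yes; no)
open import Function.Bundles using (_⇔_)

-- X = Fin n (leaf set), M = Fin k (colours).
-- A rooted tree whose leaves carry elements of X; each child of an
-- inner vertex comes with the label λ(e) ⊆ M of the edge e to it.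
data Tree (n k : ℕ) : Set where
  leaf : Fin n → Tree n k
  node : List (Subset k × Tree n k) → Tree n k

module _ {n k : ℕ} where

  mutual
    leaves : Tree n k → List (Fin n)
    leaves (leaf x)  = x ∷ []
    leaves (node cs) = leavesL cs

    leavesL : List (Subset k × Tree n k) → List (Fin n)
    leavesL []             = []
    leavesL ((_ , t) ∷ cs) = leaves t ++ leavesL cs

  _∈ₜ_ : Fin n → Tree n k → Set
  y ∈ₜ t = y LM.∈ leaves t

  -- every inner vertex has at least two children
  -- (root degree ≥ 2, non-root inner vertices degree ≥ 3)
  data InnerOK : Tree n k → Set where
    leafOK : ∀ x → InnerOK (leaf x)
    nodeOK : ∀ cs → 2 ≤ length cs → All (λ c → InnerOK (proj₂ c)) cs → InnerOK (node cs)

  data IsPhylogenetic : Tree n k → Set where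
    phylo : ∀ cs → InnerOK (node cs) → leavesL cs ↭ allFin n → IsPhylogenetic (node cs)

  -- the path from the root of t down to leaf y contains an m-edge
  data DownHas (m : Fin k) : Tree n k → Fin n → Set where
    here  : ∀ {cs L t y} → (L , t) LM.∈ cs → y ∈ₜ t → m ∈ L → DownHas m (node cs) y
    there : ∀ {cs L t y} → (L , t) LM.∈ cs → DownHas m t y → DownHas m (node cs) y

  -- the path from lca(x,y) to y contains an m-edge
  data LcaPathHas (m : Fin k) : Tree n k → Fin n → Fin n → Set where
    -- lca(x,y) is the current vertex: x and y lie below different children
    split  : ∀ {cs L₁ t₁ L₂ t₂ x y} → (L₁ , t₁) LM.∈ cs → x ∈ₜ t₁ → ¬ (y ∈ₜ t₁) →
             (L₂ , t₂) LM.∈ cs → y ∈ₜ t₂ → (m ∈ L₂ ⊎ DownHas m t₂ y) →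
             LcaPathHas m (node cs) x y
    deeper : ∀ {cs L t x y} → (L , t) LM.∈ cs → x ∈ₜ t → y ∈ₜ t →
             LcaPathHas m t x y → LcaPathHas m (node cs) x y

EpsMap : ℕ → ℕ → Set
EpsMap n k = (x y : Fin n) → x ≢ y → Subset k

Explains : ∀ {n k} → Tree n k → EpsMap n k → Set
Explains {n} {k} T ε =
  (x y : Fin n) (x≢y : x ≢ y) (m : Fin k) → (m ∈ ε x y x≢y) ⇔ LcaPathHas m T x y

IsFitch : ∀ {n k} → EpsMap n k → Set
IsFitch {n} {k} ε = Σ (Tree n k) λ T → IsPhylogenetic T × Explains T ε

Nbh : ∀ {n k} → EpsMap n k → Fin k → Fin n → Subset n
Nbh ε m y = tabulate f
  where
  f : _ → _
  f x with x ≟ y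
  ... | yes _  = inside
  ... | no x≢y with m ∈? ε x y x≢y
  ...   | yes _ = outside
  ...   | no _  = inside

-- Write x ∼ y when the path from lca(x,y) down to y carries an m-edge, so that
-- N_m[y] = {x | x ≡ y or not x ∼ y}. In a tree ∼ is cotransitive: for any leaf z, an m-edge
-- on the path from lca(x,y) to y lies either above lca(z,y), and then on the path from
-- lca(x,z) to z, or below it, on the path from lca(z,y) to y. Hence membership in the
-- neighbourhoods is transitive, and y′ ∈ N_m[y] gives N_m[y′] ⊆ N_m[y].
module Submission where

open import Defs
open import Data.Nat using (ℕ; suc; _≤_)
open import Data.Fin using (Fin; _≟_)
open import Data.Fin.Subset using (Subset; _∈_; _∉_; _⊆_; ∣_∣; inside; outside)
open import Data.Fin.Subset.Properties using (_∈?_; p⊆q⇒∣p∣≤∣q∣)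
open import Data.List using (List; []; _∷_; _++_)
import Data.List.Relation.Unary.All as All
import Data.List.Relation.Unary.All.Properties as All
open import Data.List.Relation.Unary.Any using (here; there)
open import Data.List.Relation.Unary.Unique.Propositional using (Unique; []; _∷_)
open import Data.List.Relation.Unary.Unique.Propositional.Properties using (allFin⁺)
open import Data.List.Relation.Binary.Disjoint.Propositional using (Disjoint)
open import Data.List.Relation.Binary.Permutation.Propositional using (↭-sym; ↭⇒↭ₛ)
open import Data.List.Relation.Binary.Permutation.Propositional.Properties using (∈-resp-↭)
import Data.List.Relation.Binary.Permutation.Setoid.Properties as Permutation
import Data.List.Membership.Propositional as List
import Data.List.Membership.DecPropositional as DecMembership
open import Data.List.Membership.Propositional.Properties using (∈-++⁻; ∈-++⁺ˡ; ∈-++⁺ʳ; ∈-allFin)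
open import Data.Vec using (lookup)
open import Data.Vec.Properties using ([]=⇒lookup; lookup⇒[]=; lookup∘tabulate)
open import Data.Product using (Σ; ∃; _×_; _,_; proj₂)
open import Data.Sum as Sum using (_⊎_; inj₁; inj₂)
open import Data.Empty using (⊥-elim)
open import Function.Bundles using (Equivalence)
open import Level using (0ℓ)
open import Relation.Binary.Core using (Rel)
open import Relation.Binary.Definitions using (Cotransitive; Transitive)
open import Relation.Binary.Construct.Closure.Reflexive using (ReflClosure; refl; [_])
open import Relation.Binary.PropositionalEquality using (_≡_; _≢_; refl; sym; trans; subst; setoid)
open import Relation.Nullary using (¬_; yes; no; Dec)

module _ {A : Set} where

  Unique-++⁻ˡ : ∀ xs {ys : List A} → Unique (xs ++ ys) → Unique xs
  Unique-++⁻ˡ []       _          = []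
  Unique-++⁻ˡ (x ∷ xs) (x∉ ∷ xs!) = All.++⁻ˡ xs x∉ ∷ Unique-++⁻ˡ xs xs!

  Unique-++⁻ʳ : ∀ xs {ys : List A} → Unique (xs ++ ys) → Unique ys
  Unique-++⁻ʳ []       ys!       = ys!
  Unique-++⁻ʳ (x ∷ xs) (_ ∷ xs!) = Unique-++⁻ʳ xs xs!

  Unique-++⇒Disjoint : ∀ xs {ys : List A} → Unique (xs ++ ys) → Disjoint xs ys
  Unique-++⇒Disjoint (x ∷ xs) (x∉ ∷ _) (here refl , v∈ys) = All.lookup (All.++⁻ʳ xs x∉) v∈ys refl
  Unique-++⇒Disjoint (x ∷ xs) (_ ∷ xs!) (there v∈xs , v∈ys) = Unique-++⇒Disjoint xs xs! (v∈xs , v∈ys)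

module _ {A : Set} {ℓ} {_#_ : Rel A ℓ} where

  cotransitive⇒ReflClosure-¬-transitive : Cotransitive _#_ → Transitive (ReflClosure (λ x y → ¬ x # y))
  cotransitive⇒ReflClosure-¬-transitive cotrans refl       yz         = yz
  cotransitive⇒ReflClosure-¬-transitive cotrans [ ¬x#y ]  refl       = [ ¬x#y ]
  cotransitive⇒ReflClosure-¬-transitive cotrans [ ¬x#y ]  [ ¬y#z ] =
    [ (λ x#z → Sum.[ ¬x#y , ¬y#z ] (cotrans x#z _)) ]

module _ {n k : ℕ} (ε : EpsMap n k) (m : Fin k) (y : Fin n) {x : Fin n} where

  ∈Nbh⇒ : x ∈ Nbh ε m y → x ≡ y ⊎ Σ (x ≢ y) λ x≢y → ¬ m ∈ ε x y x≢y
  -- The equation mentions the entry function of Nbh at x, so abstracting x ≟ y and then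
  -- m ∈? ε x y x≢y in it makes the entry compute.
  ∈Nbh⇒ x∈ with x ≟ y | trans (sym (lookup∘tabulate _ x)) ([]=⇒lookup x∈)
  ... | yes x≡y | _ = inj₁ x≡y
  ... | no x≢y  | e with m ∈? ε x y x≢y | e
  ...   | yes _  | ()
  ...   | no m∉ | _ = inj₂ (x≢y , m∉)

  ∉Nbh⇒ : x ∉ Nbh ε m y → Σ (x ≢ y) λ x≢y → m ∈ ε x y x≢y
  ∉Nbh⇒ x∉ with lookup (Nbh ε m y) x in eq
  ... | inside = ⊥-elim (x∉ (lookup⇒[]= x _ eq))
  ... | outside with x ≟ y | trans (sym (lookup∘tabulate _ x)) eq
  ...   | yes _   | ()
  ...   | no x≢y | e with m ∈? ε x y x≢y | e
  ...     | yes m∈ | _ = x≢y , m∈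
  ...     | no _   | ()

module _ {n k : ℕ} where

  private variable
    cs       : List (Subset k × Tree n k)
    L L′     : Subset k
    t t′     : Tree n k
    m        : Fin k
    x y z w  : Fin n

  _∈ₜ?_ : (z : Fin n) (t : Tree n k) → Dec (z ∈ₜ t)
  z ∈ₜ? t = DecMembership._∈?_ _≟_ z (leaves t)

  ∈-leavesL⁺ : (L , t) List.∈ cs → z ∈ₜ t → z List.∈ leavesL cs
  ∈-leavesL⁺ {cs = _ ∷ _}        (here refl) z∈t = ∈-++⁺ˡ z∈t
  ∈-leavesL⁺ {cs = (_ , t′) ∷ _} (there c∈)  z∈t = ∈-++⁺ʳ (leaves t′) (∈-leavesL⁺ c∈ z∈t)

  ∈-leavesL⁻ : z List.∈ leavesL cs → ∃ λ (c : Subset k × Tree n k) → c List.∈ cs × z ∈ₜ proj₂ c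
  ∈-leavesL⁻ {cs = (L , t) ∷ cs} z∈ with ∈-++⁻ (leaves t) z∈
  ... | inj₁ z∈t  = (L , t) , here refl , z∈t
  ... | inj₂ z∈cs with ∈-leavesL⁻ {cs = cs} z∈cs
  ...   | c , c∈ , z∈c = c , there c∈ , z∈c

  Unique-child : Unique (leavesL cs) → (L , t) List.∈ cs → Unique (leaves t)
  Unique-child {cs = (_ , t) ∷ _}  cs! (here refl) = Unique-++⁻ˡ (leaves t) cs!
  Unique-child {cs = (_ , t′) ∷ _} cs! (there c∈)  = Unique-child (Unique-++⁻ʳ (leaves t′) cs!) c∈

  child-unique : Unique (leavesL cs) →
                 (L , t) List.∈ cs → (L′ , t′) List.∈ cs → z ∈ₜ t → z ∈ₜ t′ → (L , t) ≡ (L′ , t′)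
  child-unique cs! (here refl) (here refl) _ _ = refl
  child-unique {cs = _ ∷ _} cs! (here refl) (there c′∈) z∈t z∈t′ =
    ⊥-elim (Unique-++⇒Disjoint _ cs! (z∈t , ∈-leavesL⁺ c′∈ z∈t′))
  child-unique {cs = _ ∷ _} cs! (there c∈)  (here refl) z∈t z∈t′ =
    ⊥-elim (Unique-++⇒Disjoint _ cs! (z∈t′ , ∈-leavesL⁺ c∈ z∈t))
  child-unique {cs = (_ , t″) ∷ _} cs! (there c∈) (there c′∈) z∈t z∈t′ =
    child-unique (Unique-++⁻ʳ (leaves t″) cs!) c∈ c′∈ z∈t z∈t′

  overlapping-children⇒⊆ : Unique (leavesL cs) → (L , t) List.∈ cs → (L′ , t′) List.∈ cs →
                           z ∈ₜ t → z ∈ₜ t′ → w ∈ₜ t′ → w ∈ₜ t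
  overlapping-children⇒⊆ cs! c∈ c′∈ z∈t z∈t′ =
    subst (λ (c : Subset k × Tree n k) → _ ∈ₜ proj₂ c) (sym (child-unique cs! c∈ c′∈ z∈t z∈t′))

  DownHas⇒∈ₜ : DownHas m t y → y ∈ₜ t
  DownHas⇒∈ₜ (here c∈ y∈t _) = ∈-leavesL⁺ c∈ y∈t
  DownHas⇒∈ₜ (there c∈ d)    = ∈-leavesL⁺ c∈ (DownHas⇒∈ₜ d)

  LcaPathHas⇒DownHas : LcaPathHas m t x y → DownHas m t y
  LcaPathHas⇒DownHas (split _ _ _ c∈ y∈t (inj₁ m∈L)) = here c∈ y∈t m∈L
  LcaPathHas⇒DownHas (split _ _ _ c∈ _   (inj₂ d))   = there c∈ d
  LcaPathHas⇒DownHas (deeper c∈ _ _ r)               = there c∈ (LcaPathHas⇒DownHas r)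

  split-outside : Unique (leavesL cs) → x List.∈ leavesL cs →
                  (L , t) List.∈ cs → y ∈ₜ t → ¬ x ∈ₜ t → m ∈ L ⊎ DownHas m t y →
                  LcaPathHas m (node cs) x y
  split-outside cs! x∈ c∈ y∈t x∉t h with ∈-leavesL⁻ x∈
  ... | _ , c′∈ , x∈c′ =
    split c′∈ x∈c′ (λ y∈c′ → x∉t (overlapping-children⇒⊆ cs! c∈ c′∈ y∈t y∈c′ x∈c′)) c∈ y∈t h

  DownHas-cotrans : Unique (leaves t) → z ∈ₜ t →
                    DownHas m t y → DownHas m t z ⊎ LcaPathHas m t z y
  DownHas-cotrans {z = z} cs! z∈ (here {t = t} c∈ y∈t m∈L) with z ∈ₜ? t
  ... | yes z∈t = inj₁ (here c∈ z∈t m∈L)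
  ... | no  z∉t = inj₂ (split-outside cs! z∈ c∈ y∈t z∉t (inj₁ m∈L))
  DownHas-cotrans {z = z} cs! z∈ (there {t = t} c∈ d) with z ∈ₜ? t
  ... | yes z∈t = Sum.map (there c∈) (deeper c∈ z∈t (DownHas⇒∈ₜ d))
                          (DownHas-cotrans (Unique-child cs! c∈) z∈t d)
  ... | no  z∉t = inj₂ (split-outside cs! z∈ c∈ (DownHas⇒∈ₜ d) z∉t (inj₂ d))

  LcaPathHas-cotrans : Unique (leaves t) → z ∈ₜ t →
                       LcaPathHas m t x y → LcaPathHas m t x z ⊎ LcaPathHas m t z y
  LcaPathHas-cotrans {z = z} cs! z∈ (deeper {t = t} c∈ x∈t y∈t r) with z ∈ₜ? t
  ... | yes z∈t = Sum.map (deeper c∈ x∈t z∈t) (deeper c∈ z∈t y∈t)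
                          (LcaPathHas-cotrans (Unique-child cs! c∈) z∈t r)
  ... | no  z∉t = inj₂ (split-outside cs! z∈ c∈ y∈t z∉t (inj₂ (LcaPathHas⇒DownHas r)))
  LcaPathHas-cotrans {z = z} {m = m} {x = x} {y = y} cs! z∈
                     (split {L₂ = L₂} {t₂ = t₂} c₁∈ x∈t₁ y∉t₁ c₂∈ y∈t₂ h) with z ∈ₜ? t₂
  ... | no  z∉t₂ = inj₂ (split-outside cs! z∈ c₂∈ y∈t₂ z∉t₂ h)
  ... | yes z∈t₂ = Sum.map (split-outside cs! (∈-leavesL⁺ c₁∈ x∈t₁) c₂∈ z∈t₂ x∉t₂)
                           (deeper c₂∈ z∈t₂ y∈t₂) (edge-or-below h)
    where
    x∉t₂ : ¬ x ∈ₜ t₂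
    x∉t₂ x∈t₂ = y∉t₁ (overlapping-children⇒⊆ cs! c₁∈ c₂∈ x∈t₁ x∈t₂ y∈t₂)

    edge-or-below : m ∈ L₂ ⊎ DownHas m t₂ y → (m ∈ L₂ ⊎ DownHas m t₂ z) ⊎ LcaPathHas m t₂ z y
    edge-or-below (inj₁ m∈L) = inj₁ (inj₁ m∈L)
    edge-or-below (inj₂ d)   = Sum.map₁ inj₂ (DownHas-cotrans (Unique-child cs! c₂∈) z∈t₂ d)

  IsPhylogenetic⇒Unique : IsPhylogenetic t → Unique (leaves t)
  IsPhylogenetic⇒Unique (phylo _ _ leaves↭X) =
    Permutation.Unique-resp-↭ (setoid (Fin n)) (↭⇒↭ₛ (↭-sym leaves↭X)) (allFin⁺ n)

  IsPhylogenetic⇒∈ₜ : IsPhylogenetic t → ∀ z → z ∈ₜ t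
  IsPhylogenetic⇒∈ₜ (phylo _ _ leaves↭X) z = ∈-resp-↭ (↭-sym leaves↭X) (∈-allFin z)

  LcaPathHas-cotransitive : IsPhylogenetic t → Cotransitive (LcaPathHas m t)
  LcaPathHas-cotransitive t-phylo r z =
    LcaPathHas-cotrans (IsPhylogenetic⇒Unique t-phylo) (IsPhylogenetic⇒∈ₜ t-phylo z) r

  TreeNbh : Fin k → Tree n k → Rel (Fin n) 0ℓ
  TreeNbh m t = ReflClosure (λ x y → ¬ LcaPathHas m t x y)

module _ {n k : ℕ} {ε : EpsMap n k} {T : Tree n k} (T-explains : Explains T ε)
         (m : Fin k) (y : Fin n) {x : Fin n} where

  ∈Nbh⇒TreeNbh : x ∈ Nbh ε m y → TreeNbh m T x y
  ∈Nbh⇒TreeNbh x∈ with ∈Nbh⇒ ε m y x∈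
  ... | inj₁ refl        = refl
  ... | inj₂ (x≢y , m∉) = [ (λ r → m∉ (Equivalence.from (T-explains x y x≢y m) r)) ]

  TreeNbh⇒∈Nbh : TreeNbh m T x y → x ∈ Nbh ε m y
  TreeNbh⇒∈Nbh r with x ∈? Nbh ε m y
  ... | yes x∈ = x∈
  ... | no  x∉ with ∉Nbh⇒ ε m y x∉ | r
  ...   | x≢y , _  | refl   = ⊥-elim (x≢y refl)
  ...   | x≢y , m∈ | [ ¬r ] = ⊥-elim (¬r (Equivalence.to (T-explains x y x≢y m) m∈))

corollary2 : (n k : ℕ) (ε : EpsMap (suc n) (suc k)) → IsFitch ε →
             (m : Fin (suc k)) (y y′ : Fin (suc n)) → y′ ∈ Nbh ε m y →
             ∣ Nbh ε m y′ ∣ ≤ ∣ Nbh ε m y ∣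
corollary2 n k ε (T , T-phylo , T-explains) m y y′ y′∈ = p⊆q⇒∣p∣≤∣q∣ Nbh-y′⊆Nbh-y
  where
  TreeNbh-trans : Transitive (TreeNbh m T)
  TreeNbh-trans = cotransitive⇒ReflClosure-¬-transitive (LcaPathHas-cotransitive T-phylo)

  Nbh-y′⊆Nbh-y : Nbh ε m y′ ⊆ Nbh ε m y
  Nbh-y′⊆Nbh-y x∈ = TreeNbh⇒∈Nbh T-explains m y
    (TreeNbh-trans (∈Nbh⇒TreeNbh T-explains m y′ x∈) (∈Nbh⇒TreeNbh T-explains m y y′∈))
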